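{- There is no first-order formula $\varphi(x,y)$ over the vocabulary $\{\subseteq\}$ such that, for every decision tree $\mathcal{T}$ and every pair of partial instances $\mathbf{e},\mathbf{e}'$ of dimension $\dim(\mathcal{T})$, $\mathcal{T}\models\varphi(\mathbf{e},\mathbf{e}')$ if and only if $|\mathbf{e}_\bot|\ge|\mathbf{e}'_\bot|$.
   Context: Partial instances of dimension $n$ are tuples in $\{0,1,\bot\}^n$; $\mathbf{e}_\bot=\{i\mid\mathbf{e}[i]=\bot\}$. A decision tree of dimension $n$ is a rooted binary tree with internal nodes labeled by features in $\{1,\dots,n\}$, edges labeled $0/1$, leaves labeled $\mathsf{true}/\mathsf{false}$, no feature repeated on a root-to-leaf path. A formula over $\{\subseteq\}$ is evaluated on $\mathcal{T}$ of dimension $n$ over the domain $\{0,1,\bot\}^n$ with $\mathbf{e}_1\subseteq\mathbf{e}_2$ iff $\mathbf{e}_1[i]=\mathbf{e}_2[i]$ for every $i$ with $\mathbf{e}_1[i]\neq\bot$ (subsumption). -}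

module Defs where

open import Data.Nat using (ℕ; zero; suc; _≤_)
open import Data.Bool using (Bool)
open import Data.Fin using (Fin)
open import Data.Vec using (Vec; lookup; []; _∷_)
open import Data.List using (List; []; _∷_)
open import Data.List.Membership.Propositional using (_∉_)
open import Data.Product using (Σ; _×_)
open import Data.Sum using (_⊎_)
open import Data.Empty using (⊥)
open import Data.Unit using (⊤)
open import Relation.Nullary using (¬_)
open import Relation.Binary.PropositionalEquality using (_≡_)

data Val : Set where
  v0 v1 bot : Val

PI : ℕ → Set
PI n = Vec Val n

countBot : ∀ {n} → PI n → ℕ
countBot [] = zero
countBot (bot ∷ e) = suc (countBot e)
countBot (v0 ∷ e) = countBot e
countBot (v1 ∷ e) = countBot e

_⊑_ : ∀ {n} → PI n → PI n → Set
_⊑_ {n} e₁ e₂ = (i : Fin n) → ¬ (lookup e₁ i ≡ bot) → lookup e₁ i ≡ lookup e₂ i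

-- Raw binary trees: internal nodes labelled by features, first subtree is the
-- 0-edge, second subtree the 1-edge; leaves labelled true/false.
data Tree (n : ℕ) : Set where
  leaf : Bool → Tree n
  node : Fin n → Tree n → Tree n → Tree n

NoRepeat : ∀ {n} → List (Fin n) → Tree n → Set
NoRepeat used (leaf _) = ⊤
NoRepeat used (node i t₀ t₁) = i ∉ used × NoRepeat (i ∷ used) t₀ × NoRepeat (i ∷ used) t₁

DecisionTree : ℕ → Set
DecisionTree n = Σ (Tree n) (NoRepeat [])

data Formula (k : ℕ) : Set where
  sub  : Fin k → Fin k → Formula k
  eq   : Fin k → Fin k → Formula k
  ¬'   : Formula k → Formula k
  _∧'_ : Formula k → Formula k → Formula k
  _∨'_ : Formula k → Formula k → Formula k
  ∃'   : Formula (suc k) → Formula k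
  ∀'   : Formula (suc k) → Formula k

_⊨_[_] : ∀ {n k} → DecisionTree n → Formula k → Vec (PI n) k → Set
T ⊨ sub x y [ ρ ] = lookup ρ x ⊑ lookup ρ y
T ⊨ eq x y [ ρ ] = lookup ρ x ≡ lookup ρ y
T ⊨ ¬' φ [ ρ ] = ¬ (T ⊨ φ [ ρ ])
T ⊨ (φ ∧' ψ) [ ρ ] = (T ⊨ φ [ ρ ]) × (T ⊨ ψ [ ρ ])
T ⊨ (φ ∨' ψ) [ ρ ] = (T ⊨ φ [ ρ ]) ⊎ (T ⊨ ψ [ ρ ])
T ⊨ ∃' φ [ ρ ] = Σ (PI _) (λ e → T ⊨ φ [ e ∷ ρ ])
T ⊨ ∀' φ [ ρ ] = (e : PI _) → T ⊨ φ [ e ∷ ρ ]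

-- A formula evaluated on k partial instances of dimension n only sees the n
-- columns (the k-tuples of values at each feature) as a multiset. Let L ≈[ t ] L′ identify column multisets that differ by
-- permuting columns and by adding or removing copies of a column already
-- occurring t times. An Ehrenfeucht–Fraïssé argument shows that formulas of
-- weight t cannot tell ≈[ t ]-related multisets apart: a column with 3(s+1)
-- copies splits under a new row into three extended columns, one of which
-- keeps s+1 copies. Now take t copies each of the columns (⊥,0) and (0,⊥):
-- both instances have t undefined features, but adding one more (0,⊥) leaves
-- the formula's truth value unchanged while making |e′_⊥| > |e_⊥|.
module Submission where

open import Defs
open import Data.Nat using (ℕ; zero; suc; _+_; _*_; _≤_; _<_; z≤n; s≤s; _≤?_)
open import Data.Nat.Properties
  using (≤-refl; ≤-reflexive; ≤-trans; ≤-pred; <⇒≤; <⇒≱; ≰⇒>; n≤1+n; 1+n≰n;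
         m≤m+n; m≤n+m; +-mono-<; +-suc; +-assoc; +-identityʳ)
open import Data.Bool using (true; false)
open import Data.Fin using (Fin)
open import Data.Vec using (Vec; []; _∷_; lookup; map; replicate; zipWith; count)
open import Data.Vec.Properties using (≡-dec; lookup-zipWith; lookup-replicate; lookup-map)
open import Data.Vec.Membership.Propositional using (_∈_)
open import Data.Vec.Relation.Unary.Any using (here; there)
open import Data.Vec.Relation.Unary.All as All using (All; _∷_)
open import Data.Vec.Relation.Unary.All.Properties using (lookup⁺; lookup⁻)
open import Data.Vec.Relation.Binary.Pointwise.Extensional using (ext; Pointwise-≡⇒≡)
open import Data.Product as Product using (Σ; ∃; ∃₂; _×_; _,_)
open import Data.Sum as Sum using (_⊎_; inj₁; inj₂)
open import Data.Unit using (tt)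
open import Relation.Nullary using (¬_; yes; no; does; contradiction)
open import Relation.Binary.Definitions using (DecidableEquality)
open import Relation.Binary.PropositionalEquality
  using (_≡_; refl; sym; trans; cong; subst; subst₂)
open import Function.Bundles using (_⇔_; Equivalence)

variable
  k n m s t : ℕ
  A : Set

pigeonhole₃ : ∀ {a b c} → 3 * m ≤ a + b + c → m ≤ a ⊎ m ≤ b ⊎ m ≤ c
pigeonhole₃ {m} {a} {b} {c} h with m ≤? a | m ≤? b | m ≤? c
... | yes m≤a | _        | _        = inj₁ m≤a
... | no _    | yes m≤b  | _        = inj₂ (inj₁ m≤b)
... | no _    | no _     | yes m≤c  = inj₂ (inj₂ m≤c)
... | no m≰a  | no m≰b   | no m≰c   = contradiction h (<⇒≱ (subst (a + b + c <_) sum≡3m sum<sum))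
  where
  sum<sum : a + b + c < m + m + m
  sum<sum = +-mono-< (+-mono-< (≰⇒> m≰a) (≰⇒> m≰b)) (≰⇒> m≰c)
  sum≡3m : m + m + m ≡ 3 * m
  sum≡3m = trans (+-assoc m m m) (cong (λ z → m + (m + z)) (sym (+-identityʳ m)))

Col : ℕ → Set
Col k = Vec Val k

_≟ᵥ_ : DecidableEquality Val
v0  ≟ᵥ v0  = yes refl
v1  ≟ᵥ v1  = yes refl
bot ≟ᵥ bot = yes refl
v0  ≟ᵥ v1  = no λ ()
v0  ≟ᵥ bot = no λ ()
v1  ≟ᵥ v0  = no λ ()
v1  ≟ᵥ bot = no λ ()
bot ≟ᵥ v0  = no λ ()
bot ≟ᵥ v1  = no λ ()

_≟ᶜ_ : DecidableEquality (Col k)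
_≟ᶜ_ = ≡-dec _≟ᵥ_

occ : Col k → Vec (Col k) n → ℕ
occ c = count (c ≟ᶜ_)

addRow : PI n → Vec (Col k) n → Vec (Col (suc k)) n
addRow = zipWith _∷_

columns : Vec (PI n) k → Vec (Col k) n
columns {n} []      = replicate n []
columns     (e ∷ ρ) = addRow e (columns ρ)

occ-here : (c : Col k) (L : Vec (Col k) n) → occ c (c ∷ L) ≡ suc (occ c L)
occ-here c L with c ≟ᶜ c
... | yes _   = refl
... | no c≢c  = contradiction refl c≢c

occ-∷-≤ : (c d : Col k) (L : Vec (Col k) n) → occ c L ≤ occ c (d ∷ L)
occ-∷-≤ c d L with does (c ≟ᶜ d)
... | true  = n≤1+n _
... | false = ≤-refl

occ⇒∈ : (c : Col k) (L : Vec (Col k) n) → 0 < occ c L → c ∈ L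
occ⇒∈ c (d ∷ L) pos with c ≟ᶜ d
... | yes c≡d = here c≡d
... | no _    = there (occ⇒∈ c L pos)

occ-addRow : (c : Col k) (e : PI n) (L : Vec (Col k) n) →
             occ c L ≡ occ (v0 ∷ c) (addRow e L) + occ (v1 ∷ c) (addRow e L) + occ (bot ∷ c) (addRow e L)
occ-addRow c []      []      = refl
occ-addRow c (a ∷ e) (d ∷ L) with does (c ≟ᶜ d) | occ-addRow c e L
occ-addRow c (v0  ∷ e) (d ∷ L) | false | ih = ih
occ-addRow c (v1  ∷ e) (d ∷ L) | false | ih = ih
occ-addRow c (bot ∷ e) (d ∷ L) | false | ih = ih
occ-addRow c (v0  ∷ e) (d ∷ L) | true  | ih = cong suc ih
occ-addRow c (v1  ∷ e) (d ∷ L) | true  | ih =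
  trans (cong suc ih) (cong (_+ occ (bot ∷ c) (addRow e L)) (sym (+-suc _ _)))
occ-addRow c (bot ∷ e) (d ∷ L) | true  | ih = trans (cong suc ih) (sym (+-suc _ _))

popular-extension : (c : Col k) (L : Vec (Col k) n) (e : PI n) →
                    3 * suc s ≤ occ c L → ∃ λ v → suc s ≤ occ (v ∷ c) (addRow e L)
popular-extension c L e h with pigeonhole₃ (subst (_ ≤_) (occ-addRow c e L) h)
... | inj₁ p        = v0 , p
... | inj₂ (inj₁ p) = v1 , p
... | inj₂ (inj₂ p) = bot , p

infix 4 _↭_ _≈[_]_

data _↭_ {A : Set} : Vec A n → Vec A n → Set where
  ↭-refl  : {xs : Vec A n} → xs ↭ xs
  prep    : {xs ys : Vec A n} (x : A) → xs ↭ ys → x ∷ xs ↭ x ∷ ys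
  swap    : (x y : A) (xs : Vec A n) → x ∷ y ∷ xs ↭ y ∷ x ∷ xs
  ↭-trans : {xs ys zs : Vec A n} → xs ↭ ys → ys ↭ zs → xs ↭ zs

↭-sym : {xs ys : Vec A n} → xs ↭ ys → ys ↭ xs
↭-sym ↭-refl        = ↭-refl
↭-sym (prep x p)    = prep x (↭-sym p)
↭-sym (swap x y xs) = swap y x xs
↭-sym (↭-trans p q) = ↭-trans (↭-sym q) (↭-sym p)

occ-↭ : {c : Col k} {L L′ : Vec (Col k) n} → L ↭ L′ → occ c L ≡ occ c L′
occ-↭         ↭-refl        = refl
occ-↭ {c = c} (prep d p) with does (c ≟ᶜ d) | occ-↭ {c = c} p
... | true  | ih = cong suc ih
... | false | ih = ih
occ-↭ {c = c} (swap x y L) with does (c ≟ᶜ x) | does (c ≟ᶜ y)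
... | true  | true  = refl
... | true  | false = refl
... | false | true  = refl
... | false | false = refl
occ-↭         (↭-trans p q) = trans (occ-↭ p) (occ-↭ q)

All-resp-↭ : {P : A → Set} {xs ys : Vec A n} → xs ↭ ys → All P xs → All P ys
All-resp-↭ ↭-refl        a                = a
All-resp-↭ (prep x p)    (px ∷ a)         = px ∷ All-resp-↭ p a
All-resp-↭ (swap x y xs) (px ∷ py ∷ a)    = py ∷ px ∷ a
All-resp-↭ (↭-trans p q) a                = All-resp-↭ q (All-resp-↭ p a)

addRow-↭ : {L L′ : Vec (Col k) n} → L ↭ L′ → (e : PI n) → ∃ λ e′ → addRow e L ↭ addRow e′ L′
addRow-↭ ↭-refl        e           = e , ↭-refl
addRow-↭ (prep c p)    (x ∷ e)     = Product.map (x ∷_) (prep (x ∷ c)) (addRow-↭ p e)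
addRow-↭ (swap c d L)  (x ∷ y ∷ e) = y ∷ x ∷ e , swap (x ∷ c) (y ∷ d) (addRow e L)
addRow-↭ (↭-trans p q) e with addRow-↭ p e
... | e′ , p′ = Product.map₂ (↭-trans p′) (addRow-↭ q e′)

relabel-occurrence : {v : Val} {c : Col k} (e : PI (suc n)) (L : Vec (Col k) (suc n)) → v ∷ c ∈ addRow e L →
                     (x : Val) → ∃₂ λ e′ R → addRow e L ↭ (v ∷ c) ∷ R × addRow e′ L ↭ (x ∷ c) ∷ R
relabel-occurrence (a ∷ e)         (d ∷ L)         (here refl) x = x ∷ e , addRow e L , ↭-refl , ↭-refl
relabel-occurrence (a ∷ [])        (d ∷ [])        (there ())
relabel-occurrence (a ∷ e@(_ ∷ _)) (d ∷ L@(_ ∷ _)) (there p)   x with relabel-occurrence e L p x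
... | e′ , R , q , q′ =
  a ∷ e′ , (a ∷ d) ∷ R , ↭-trans (prep _ q) (swap _ _ R) , ↭-trans (prep _ q′) (swap _ _ R)

data _≈[_]_ {k : ℕ} : Vec (Col k) n → ℕ → Vec (Col k) m → Set where
  perm    : {L L′ : Vec (Col k) n} → L ↭ L′ → L ≈[ t ] L′
  dup     : (c : Col k) {L : Vec (Col k) n} → t ≤ occ c L → L ≈[ t ] c ∷ L
  undup   : (c : Col k) {L : Vec (Col k) n} → t ≤ occ c L → c ∷ L ≈[ t ] L
  ≈-trans : {L : Vec (Col k) n} {L′ : Vec (Col k) m} {L″ : Vec (Col k) s} →
            L ≈[ t ] L′ → L′ ≈[ t ] L″ → L ≈[ t ] L″

≈-sym : {L : Vec (Col k) n} {L′ : Vec (Col k) m} → L ≈[ t ] L′ → L′ ≈[ t ] L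
≈-sym (perm p)      = perm (↭-sym p)
≈-sym (dup c h)     = undup c h
≈-sym (undup c h)   = dup c h
≈-sym (≈-trans p q) = ≈-trans (≈-sym q) (≈-sym p)

≈-mono : {L : Vec (Col k) n} {L′ : Vec (Col k) m} → s ≤ t → L ≈[ t ] L′ → L ≈[ s ] L′
≈-mono s≤t (perm p)      = perm p
≈-mono s≤t (dup c h)     = dup c (≤-trans s≤t h)
≈-mono s≤t (undup c h)   = undup c (≤-trans s≤t h)
≈-mono s≤t (≈-trans p q) = ≈-trans (≈-mono s≤t p) (≈-mono s≤t q)

All-resp-≈ : {P : Col k → Set} {L : Vec (Col k) n} {L′ : Vec (Col k) m} →
             0 < t → L ≈[ t ] L′ → All P L → All P L′
All-resp-≈ t>0 (perm p)             a       = All-resp-↭ p a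
All-resp-≈ t>0 (dup c {L} h)        a       = All.lookup a (occ⇒∈ c L (≤-trans t>0 h)) ∷ a
All-resp-≈ t>0 (undup c h)          (_ ∷ a) = a
All-resp-≈ t>0 (≈-trans p q)        a       = All-resp-≈ t>0 q (All-resp-≈ t>0 p a)

-- Relabel one copy of a popular extension v ∷ c to x ∷ c; the two sides then
-- differ by one copy of v ∷ c, which still occurs s times and so can be dropped.
undup-addRow : (c : Col k) (L : Vec (Col k) n) → 3 * suc s ≤ occ c L → (x : Val) (e : PI n) →
               ∃ λ e′ → (x ∷ c) ∷ addRow e L ≈[ s ] addRow e′ L
undup-addRow c [] () x e
undup-addRow {s = s} c L@(_ ∷ _) h x e with popular-extension c L e h
... | v , many with relabel-occurrence e L (occ⇒∈ _ _ (≤-trans (s≤s z≤n) many)) x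
... | e′ , R , q , q′ =
  e′ , ≈-trans (perm (↭-trans (prep _ q) (swap _ _ R)))
                (≈-trans (undup (v ∷ c) enough) (perm (↭-sym q′)))
  where
  enough : s ≤ occ (v ∷ c) ((x ∷ c) ∷ R)
  enough = ≤-trans (≤-pred (subst (suc s ≤_) (trans (occ-↭ q) (occ-here (v ∷ c) R)) many))
                   (occ-∷-≤ (v ∷ c) (x ∷ c) R)

addRow-≈ : {L : Vec (Col k) n} {L′ : Vec (Col k) m} →
           L ≈[ 3 * suc s ] L′ → (e : PI n) → ∃ λ e′ → addRow e L ≈[ s ] addRow e′ L′
addRow-≈ (perm p)      e = Product.map₂ perm (addRow-↭ p e)
addRow-≈ (dup c {L} h) e with popular-extension c L e h
... | v , many = v ∷ e , dup (v ∷ c) (<⇒≤ many)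
addRow-≈ (undup c {L} h) (x ∷ e) = undup-addRow c L h x e
addRow-≈ (≈-trans p q) e with addRow-≈ p e
... | e′ , p′ = Product.map₂ (≈-trans p′) (addRow-≈ q e′)

lookup-columns : (ρ : Vec (PI n) k) (i : Fin n) (x : Fin k) →
                 lookup (lookup (columns ρ) i) x ≡ lookup (lookup ρ x) i
lookup-columns ρ i x = trans (cong (λ c → lookup c x) (column ρ)) (lookup-map x (λ e → lookup e i) ρ)
  where
  column : (ρ : Vec (PI _) k) → lookup (columns ρ) i ≡ map (λ e → lookup e i) ρ
  column []      = lookup-replicate i []
  column (e ∷ ρ) = trans (lookup-zipWith _∷_ i e (columns ρ)) (cong (lookup e i ∷_) (column ρ))

Coordinatewise : (Val → Val → Set) → Fin k → Fin k → Vec (PI n) k → Set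
Coordinatewise {n = n} R x y ρ = (i : Fin n) → R (lookup (lookup ρ x) i) (lookup (lookup ρ y) i)

Coordinatewise-resp-≈ : (R : Val → Val → Set) (x y : Fin k) (ρ : Vec (PI n) k) (ρ′ : Vec (PI m) k) →
                        0 < t → columns ρ ≈[ t ] columns ρ′ →
                        Coordinatewise R x y ρ → Coordinatewise R x y ρ′
Coordinatewise-resp-≈ R x y ρ ρ′ t>0 r h i =
  subst₂ R (lookup-columns ρ′ i x) (lookup-columns ρ′ i y) (lookup⁺ (All-resp-≈ t>0 r all) i)
  where
  all : All (λ c → R (lookup c x) (lookup c y)) (columns ρ)
  all = lookup⁻ λ j → subst₂ R (sym (lookup-columns ρ j x)) (sym (lookup-columns ρ j y)) (h j)

_⊑ᵥ_ : Val → Val → Set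
a ⊑ᵥ b = ¬ a ≡ bot → a ≡ b

weight : Formula k → ℕ
weight (sub _ _) = 1
weight (eq _ _)  = 1
weight (¬' φ)    = weight φ
weight (φ ∧' ψ)  = weight φ + weight ψ
weight (φ ∨' ψ)  = weight φ + weight ψ
weight (∃' φ)    = 3 * suc (weight φ)
weight (∀' φ)    = 3 * suc (weight φ)

⊨-resp-≈ : (φ : Formula k) (T : DecisionTree n) (T′ : DecisionTree m) (ρ : Vec (PI n) k) (ρ′ : Vec (PI m) k) →
           columns ρ ≈[ weight φ ] columns ρ′ → T ⊨ φ [ ρ ] → T′ ⊨ φ [ ρ′ ]
⊨-resp-≈ (sub x y) T T′ ρ ρ′ r = Coordinatewise-resp-≈ _⊑ᵥ_ x y ρ ρ′ ≤-refl r
⊨-resp-≈ (eq x y)  T T′ ρ ρ′ r x≡y =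
  Pointwise-≡⇒≡ (ext (Coordinatewise-resp-≈ _≡_ x y ρ ρ′ ≤-refl r λ i → cong (λ e → lookup e i) x≡y))
⊨-resp-≈ (¬' φ)    T T′ ρ ρ′ r ¬φ φ′ = ¬φ (⊨-resp-≈ φ T′ T ρ′ ρ (≈-sym r) φ′)
⊨-resp-≈ (φ ∧' ψ)  T T′ ρ ρ′ r =
  Product.map (⊨-resp-≈ φ T T′ ρ ρ′ (≈-mono (m≤m+n _ _) r)) (⊨-resp-≈ ψ T T′ ρ ρ′ (≈-mono (m≤n+m _ _) r))
⊨-resp-≈ (φ ∨' ψ)  T T′ ρ ρ′ r =
  Sum.map (⊨-resp-≈ φ T T′ ρ ρ′ (≈-mono (m≤m+n _ _) r)) (⊨-resp-≈ ψ T T′ ρ ρ′ (≈-mono (m≤n+m _ _) r))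
⊨-resp-≈ (∃' φ)    T T′ ρ ρ′ r (e , φe) with addRow-≈ r e
... | e′ , r′ = e′ , ⊨-resp-≈ φ T T′ (e ∷ ρ) (e′ ∷ ρ′) r′ φe
⊨-resp-≈ (∀' φ)    T T′ ρ ρ′ r ∀φ e′ with addRow-≈ (≈-sym r) e′
... | e , r′ = ⊨-resp-≈ φ T T′ (e ∷ ρ) (e′ ∷ ρ′) (≈-sym r′) (∀φ e)

alternating : (t : ℕ) → Val → Val → PI (t * 2)
alternating zero    a b = []
alternating (suc t) a b = a ∷ b ∷ alternating t a b

countBot-alternating-⊥0 : (t : ℕ) → countBot (alternating t bot v0) ≡ t
countBot-alternating-⊥0 zero    = refl
countBot-alternating-⊥0 (suc t) = cong suc (countBot-alternating-⊥0 t)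

countBot-alternating-0⊥ : (t : ℕ) → countBot (alternating t v0 bot) ≡ t
countBot-alternating-0⊥ zero    = refl
countBot-alternating-0⊥ (suc t) = cong suc (countBot-alternating-0⊥ t)

occ-columns-alternating : (t : ℕ) →
  occ (v0 ∷ bot ∷ []) (columns (alternating t bot v0 ∷ alternating t v0 bot ∷ [])) ≡ t
occ-columns-alternating zero    = refl
occ-columns-alternating (suc t) = cong suc (occ-columns-alternating t)

lemma15 : ¬ Σ (Formula 2) (λ φ → (n : ℕ) (T : DecisionTree n) (e e′ : PI n) →
            ((T ⊨ φ [ e ∷ e′ ∷ [] ]) ⇔ (countBot e′ ≤ countBot e)))
lemma15 (φ , defines) = 1+n≰n overshoot
  where
  w : ℕ
  w = weight φ
  e₁ e₂ : PI (w * 2)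
  e₁ = alternating w bot v0
  e₂ = alternating w v0 bot
  bots₁ : countBot e₁ ≡ w
  bots₁ = countBot-alternating-⊥0 w
  bots₂ : countBot e₂ ≡ w
  bots₂ = countBot-alternating-0⊥ w
  tree : DecisionTree n
  tree = leaf true , tt
  balanced : tree ⊨ φ [ e₁ ∷ e₂ ∷ [] ]
  balanced = Equivalence.from (defines _ tree e₁ e₂) (≤-reflexive (trans bots₂ (sym bots₁)))
  unbalanced : tree ⊨ φ [ (v0 ∷ e₁) ∷ (bot ∷ e₂) ∷ [] ]
  unbalanced = ⊨-resp-≈ φ tree tree _ _
                 (dup (v0 ∷ bot ∷ []) (≤-reflexive (sym (occ-columns-alternating w)))) balanced
  overshoot : suc w ≤ w
  overshoot = subst₂ _≤_ (cong suc bots₂) bots₁ (Equivalence.to (defines _ tree _ _) unbalanced)
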